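{- Let $X=(x_{ij})$ and $\bar X=(\bar x_{ij})$ be similar stable graphs of order $n$ (so they have the same cell partition), and let $S\subseteq[n]$ be a nonempty union of cells. Then the principal submatrices $(x_{ij})_{i,j\in S}$ and $(\bar x_{ij})_{i,j\in S}$ (with $S$ identified with $[|S|]$ order-preservingly) are similar stable graphs.
   Context: Labeled graphs: $\mathrm{Var}$ is an infinite set of independent variables and $x_0\notin\mathrm{Var}$ a reserved symbol. A labeled graph of order $n$ is an $n\times n$ matrix $G=(g_{ij})$ with entries in $\{x_0\}\cup\mathrm{Var}$; $g_{ii}$ is the label of vertex $i$. Diamond product: $(G\diamond G)_{ij}=\{\!\{(g_{ik},g_{kj}):k\in[n]\}\!\}$. $\mathrm{evs}(A)$ replaces entries of $A$ by variables of $\mathrm{Var}$ so that equal entries get equal variables and distinct entries distinct ones. $A\ge B$ means $b_{uv}=b_{st}\Rightarrow a_{uv}=a_{st}$; $A\approx B$ means $A\ge B$ and $B\ge A$. A stable graph is a graph $X$ with $x_{ii}\ne x_{uv}$ for all $i$ and $u\ne v$ and $\mathrm{evs}(X\diamond X)\approx X$. A cell is a maximal set of vertices with equal diagonal labels. Similarity: stable graphs $X,\bar X$ of order $N$ with the same cell partition are similar if (i) for every $i$, $\{\!\{x_{ik}:k\in[N]\}\!\}=\{\!\{\bar x_{ik}:k\in[N]\}\!\}$ and $\{\!\{x_{ki}:k\}\!\}=\{\!\{\bar x_{ki}:k\}\!\}$; (ii) for all $u,v,r,s\in[N]$, $x_{uv}=\bar x_{rs}$ iff $\{\!\{(x_{uk},x_{kv}):k\in[N]\}\!\}=\{\!\{(\bar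 x_{rk},\bar x_{ks}):k\in[N]\}\!\}$. -}

module Defs where

open import Data.Nat using (ℕ)
open import Data.Fin using (Fin; _<_)
open import Data.List using (List; map; allFin)
open import Data.List.Relation.Binary.Permutation.Propositional using (_↭_)
open import Data.Product using (_×_; _,_; ∃)
open import Relation.Binary.PropositionalEquality using (_≡_; _≢_)
open import Relation.Nullary using (¬_)
open import Function.Bundles using (_⇔_)

-- Labels: the reserved symbol x₀ together with the infinite set Var of
-- variables (indexed by ℕ).
data Label : Set where
  x₀  : Label
  var : ℕ → Label

Graph : ℕ → Set
Graph n = Fin n → Fin n → Label

-- Multiset of pairs {{(g_ik, g_kj) : k ∈ [n]}}, represented as a list;
-- multiset equality is permutation equivalence _↭_.
Multiset : Set → Set
Multiset A = List A

diamond : ∀ {n} → Graph n → Fin n → Fin n → Multiset (Label × Label)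
diamond {n} G i j = map (λ k → (G i k , G k j)) (allFin n)

rowMS : ∀ {n} → Graph n → Fin n → Multiset Label
rowMS {n} G i = map (λ k → G i k) (allFin n)

colMS : ∀ {n} → Graph n → Fin n → Multiset Label
colMS {n} G i = map (λ k → G k i) (allFin n)

Geq : ∀ {n} {A B : Set} (_≈A_ : A → A → Set) (_≈B_ : B → B → Set) →
      (Fin n → Fin n → A) → (Fin n → Fin n → B) → Set
Geq {n} _≈A_ _≈B_ M N = ∀ (u v s t : Fin n) → N u v ≈B N s t → M u v ≈A M s t

-- evs(X ◇ X) ≈ X.  Since evs replaces entries by variables injectively
-- (equal entries ↦ equal variables, distinct ↦ distinct), evs(A) has
-- exactly the equality pattern of A, so we compare the equality pattern of
-- X ◇ X (multiset equality) with that of X directly.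
DiamondStable : ∀ {n} → Graph n → Set
DiamondStable X =
  Geq _↭_ _≡_ (diamond X) X × Geq _≡_ _↭_ X (diamond X)

Stable : ∀ {n} → Graph n → Set
Stable {n} X =
  (∀ (i u v : Fin n) → u ≢ v → X i i ≢ X u v) × DiamondStable X

-- Same cell partition: i and j lie in the same cell iff their diagonal
-- labels coincide.
SameCells : ∀ {n} → Graph n → Graph n → Set
SameCells {n} X Y = ∀ (i j : Fin n) → (X i i ≡ X j j) ⇔ (Y i i ≡ Y j j)

Similar : ∀ {n} → Graph n → Graph n → Set
Similar {n} X Y =
  Stable X × Stable Y × SameCells X Y
  × (∀ (i : Fin n) → (rowMS X i ↭ rowMS Y i) × (colMS X i ↭ colMS Y i))
  × (∀ (u v r s : Fin n) → (X u v ≡ Y r s) ⇔ (diamond X u v ↭ diamond Y r s))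

Subset : ℕ → Set₁
Subset n = Fin n → Set

NonemptyS : ∀ {n} → Subset n → Set
NonemptyS S = ∃ λ i → S i

UnionOfCells : ∀ {n} → Graph n → Subset n → Set
UnionOfCells {n} X S = ∀ (i j : Fin n) → X i i ≡ X j j → S i → S j

OrderEnum : ∀ {n m} → Subset n → (Fin m → Fin n) → Set
OrderEnum {n} {m} S e =
  (∀ (a b : Fin m) → a < b → e a < e b)
  × (∀ (j : Fin n) → S j ⇔ (∃ λ a → e a ≡ j))

sub : ∀ {n m} → Graph n → (Fin m → Fin n) → Graph m
sub X e a b = X (e a) (e b)

{-# OPTIONS --safe #-}
-- Every entry x_wk determines the cell of its column k (and of its row w): the
-- k-th term (x_wk, x_kk) of (X ◇ X)_wk contains the diagonal label x_kk, and
-- diagonal labels never occur off the diagonal.  So if x_w′k′ = x̄_wk, similarity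
-- forces k′ and k into the same cell, and whether k ∈ S can be read off from the
-- label x̄_wk alone.  Filtering the multisets of rows, columns and of X ◇ X by this
-- label predicate turns each defining multiset equality of X and X̄ into the one
-- for the principal submatrices.  Conversely, equal diamond multisets force equal
-- entries, again by locating the diagonal label x_uu in (X ◇ X)_uv.
module Submission where

open import Defs
open import Data.Nat using (ℕ)
open import Data.Fin using (Fin; _<_)
open import Data.Fin.Properties using (<-cmp; <-irrefl; any?) renaming (_≟_ to _≟ᶠ_)
open import Data.List using (List; []; _∷_; map; allFin; filter)
open import Data.List.Properties using (map-∘; filter-≐)
open import Data.List.Membership.Propositional using (_∈_)
open import Data.List.Membership.Propositional.Properties
  using (∈-map⁺; ∈-map⁻; ∈-filter⁺; ∈-filter⁻; ∈-allFin)
open import Data.List.Membership.Propositional.Properties.WithK using (unique∧set⇒bag)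
open import Data.List.Relation.Binary.BagAndSetEquality using (∼bag⇒↭)
open import Data.List.Relation.Binary.Permutation.Propositional
  using (_↭_; ↭-refl; ↭-sym; module PermutationReasoning)
open import Data.List.Relation.Binary.Permutation.Propositional.Properties
  using (∈-resp-↭; filter-↭; map⁺)
import Data.List.Relation.Unary.Unique.Propositional.Properties as Unique
open import Data.Nat.Properties using () renaming (_≟_ to _≟ℕ_)
open import Data.Product using (_×_; _,_; ∃; proj₁; proj₂)
open import Data.Empty using (⊥-elim)
open import Function using (_∘_)
open import Function.Bundles using (_⇔_; mk⇔; Equivalence)
open import Function.Definitions using (Injective)
open import Relation.Binary.Definitions using (DecidableEquality; tri<; tri≈; tri>)
open import Relation.Binary.PropositionalEquality using (_≡_; _≢_; refl; sym; trans; cong)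
open import Relation.Nullary using (yes; no)
open import Relation.Nullary.Decidable using (decidable-stable; _×-dec_)
open import Relation.Unary using (Decidable; _≐_)

_≟ᴸ_ : DecidableEquality Label
x₀    ≟ᴸ x₀    = yes refl
x₀    ≟ᴸ var _ = no λ ()
var _ ≟ᴸ x₀    = no λ ()
var i ≟ᴸ var j with i ≟ℕ j
... | yes refl = yes refl
... | no i≢j   = no λ { refl → i≢j refl }

strictlyIncreasing⇒injective : ∀ {m n} {e : Fin m → Fin n} →
  (∀ a b → a < b → e a < e b) → Injective _≡_ _≡_ e
strictlyIncreasing⇒injective {e = e} increasing {a} {b} ea≡eb with <-cmp a b
... | tri< a<b _ _ = ⊥-elim (<-irrefl ea≡eb (increasing a b a<b))
... | tri≈ _ a≡b _ = a≡b
... | tri> _ _ b<a = ⊥-elim (<-irrefl (sym ea≡eb) (increasing b a b<a))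

map-allFin-↭⇒preimage : ∀ {n} {A : Set} {f g : Fin n → A} →
  map f (allFin n) ↭ map g (allFin n) → ∀ k → ∃ λ j → f j ≡ g k
map-allFin-↭⇒preimage {f = f} {g} f↭g k
  with j , _ , gk≡fj ← ∈-map⁻ f (∈-resp-↭ (↭-sym f↭g) (∈-map⁺ g (∈-allFin k)))
  = j , sym gk≡fj

filter-map : ∀ {A B : Set} {Q : B → Set} (Q? : Decidable Q) (h : A → B) (xs : List A) →
  filter Q? (map h xs) ≡ map h (filter (Q? ∘ h) xs)
filter-map Q? h []       = refl
filter-map Q? h (x ∷ xs) with Q? (h x)
... | yes _ = cong (h x ∷_) (filter-map Q? h xs)
... | no  _ = filter-map Q? h xs

Image : ∀ {m n} → (Fin m → Fin n) → Fin n → Set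
Image e j = ∃ λ a → e a ≡ j

image? : ∀ {m n} (e : Fin m → Fin n) → Decidable (Image e)
image? e j = any? (λ a → e a ≟ᶠ j)

module _ {m n} (e : Fin m → Fin n) (e-injective : Injective _≡_ _≡_ e) where

  filter-image-allFin : filter (image? e) (allFin n) ↭ map e (allFin m)
  filter-image-allFin = ∼bag⇒↭ (unique∧set⇒bag
    (Unique.filter⁺ (image? e) (Unique.allFin⁺ n))
    (Unique.map⁺ e-injective (Unique.allFin⁺ m))
    (mk⇔ to from))
    where
    to : ∀ {j} → j ∈ filter (image? e) (allFin n) → j ∈ map e (allFin m)
    to j∈ with _ , (a , refl) ← ∈-filter⁻ (image? e) {xs = allFin n} j∈ = ∈-map⁺ e (∈-allFin a)
    from : ∀ {j} → j ∈ map e (allFin m) → j ∈ filter (image? e) (allFin n)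
    from {j} j∈ with a , _ , j≡ea ← ∈-map⁻ e j∈ = ∈-filter⁺ (image? e) (∈-allFin j) (a , sym j≡ea)

  module _ {A : Set} {Q : A → Set} (Q? : Decidable Q) where

    map-∘-↭-filter : ∀ {h : Fin n → A} → (∀ k → Q (h k) ⇔ Image e k) →
      map (h ∘ e) (allFin m) ↭ filter Q? (map h (allFin n))
    map-∘-↭-filter {h} Q∘h⇔image = begin
      map (h ∘ e) (allFin m)               ≡⟨ map-∘ (allFin m) ⟩
      map h (map e (allFin m))             ↭⟨ map⁺ h (↭-sym filter-image-allFin) ⟩
      map h (filter (image? e) (allFin n)) ≡⟨ cong (map h) (filter-≐ (image? e) (Q? ∘ h) image≐Q∘h (allFin n)) ⟩
      map h (filter (Q? ∘ h) (allFin n))   ≡⟨ filter-map Q? h (allFin n) ⟨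
      filter Q? (map h (allFin n))         ∎
      where
      open PermutationReasoning
      image≐Q∘h : Image e ≐ Q ∘ h
      image≐Q∘h = (λ {k} → Equivalence.from (Q∘h⇔image k)) , (λ {k} → Equivalence.to (Q∘h⇔image k))

    map-∘-↭ : ∀ {h h′ : Fin n → A} → (∀ k → Q (h k) ⇔ Image e k) → (∀ k → Q (h′ k) ⇔ Image e k) →
      map h (allFin n) ↭ map h′ (allFin n) → map (h ∘ e) (allFin m) ↭ map (h′ ∘ e) (allFin m)
    map-∘-↭ {h} {h′} Q∘h⇔image Q∘h′⇔image h↭h′ = begin
      map (h ∘ e) (allFin m)        ↭⟨ map-∘-↭-filter Q∘h⇔image ⟩
      filter Q? (map h (allFin n))  ↭⟨ filter-↭ Q? h↭h′ ⟩
      filter Q? (map h′ (allFin n)) ↭⟨ map-∘-↭-filter Q∘h′⇔image ⟨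
      map (h′ ∘ e) (allFin m)       ∎
      where open PermutationReasoning

DiagonalApart : ∀ {n} → Graph n → Set
DiagonalApart {n} X = ∀ (i u v : Fin n) → u ≢ v → X i i ≢ X u v

DiamondRespects : ∀ {n} → Graph n → Graph n → Set
DiamondRespects {n} Y Z = ∀ (u v r s : Fin n) → Y u v ≡ Z r s → diamond Y u v ↭ diamond Z r s

module _ {n : ℕ} where

  apart⇒diagonal : ∀ {Z : Graph n} → DiagonalApart Z → ∀ {i u v} → Z u v ≡ Z i i → u ≡ v
  apart⇒diagonal apart {i} {u} {v} Zuv≡Zii =
    decidable-stable (u ≟ᶠ v) (λ u≢v → apart i u v u≢v (sym Zuv≡Zii))

  apart-sub : ∀ {m} {X : Graph n} {e : Fin m → Fin n} →
    Injective _≡_ _≡_ e → DiagonalApart X → DiagonalApart (sub X e)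
  apart-sub e-injective apart i u v u≢v = apart _ _ _ (u≢v ∘ e-injective)

  diamond-↭⇒match : ∀ {Y Z : Graph n} {u v r s} → diamond Y u v ↭ diamond Z r s →
    ∀ k → ∃ λ j → Y u k ≡ Z r j × Y k v ≡ Z j s
  diamond-↭⇒match p k with j , Zpair≡Ypair ← map-allFin-↭⇒preimage (↭-sym p) k
    = j , cong proj₁ (sym Zpair≡Ypair) , cong proj₂ (sym Zpair≡Ypair)

  module _ {Y Z : Graph n} (apart : DiagonalApart Z) where

    diamond-↭⇒≡ : (∀ i → Y i i ≡ Z i i) →
      ∀ {u v r s} → diamond Y u v ↭ diamond Z r s → Y u v ≡ Z r s
    diamond-↭⇒≡ diagonal {u} {r = r} p
      with j , Yuu≡Zrj , Yuv≡Zjs ← diamond-↭⇒match {Y} {Z} p u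
      with refl ← apart⇒diagonal apart {u = r} {j} (trans (sym Yuu≡Zrj) (diagonal u))
      = Yuv≡Zjs

    respects⇒diagonal : (∀ i → rowMS Y i ↭ rowMS Z i) → DiamondRespects Y Z →
      ∀ i → Y i i ≡ Z i i
    respects⇒diagonal rows respects i
      with j , Yij≡Zii ← map-allFin-↭⇒preimage (rows i) i
      with k , Yii≡Zik , Yij≡Zki ← diamond-↭⇒match {Y} {Z} (respects i j i i Yij≡Zii) i
      with refl ← apart⇒diagonal apart {u = k} {i} (trans (sym Yij≡Zki) Yij≡Zii)
      = Yii≡Zik

    module _ (respects : DiamondRespects Y Z) (diagonal : ∀ i → Y i i ≡ Z i i) where

      column-cell : ∀ {w k r k′} → Y w k ≡ Z r k′ → Y k k ≡ Z k′ k′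
      column-cell {w} {k} {r} {k′} eq
        with j , _ , Ykk≡Zjk′ ← diamond-↭⇒match {Y} {Z} (respects w k r k′ eq) k
        with refl ← apart⇒diagonal apart {u = j} {k′} (trans (sym Ykk≡Zjk′) (diagonal k))
        = Ykk≡Zjk′

      row-cell : ∀ {k w k′ r} → Y k w ≡ Z k′ r → Y k k ≡ Z k′ k′
      row-cell {k} {w} {k′} {r} eq
        with j , Ykk≡Zk′j , _ ← diamond-↭⇒match {Y} {Z} (respects k w k′ r eq) k
        with refl ← apart⇒diagonal apart {u = k′} {j} (trans (sym Ykk≡Zk′j) (diagonal k))
        = Ykk≡Zk′j

record Compatible {n} (X Y : Graph n) : Set where
  field
    respects : DiamondRespects X Y
    apart    : DiagonalApart Y
    rows     : ∀ i → rowMS X i ↭ rowMS Y i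
    cols     : ∀ i → colMS X i ↭ colMS Y i

  diagonal : ∀ i → X i i ≡ Y i i
  diagonal = respects⇒diagonal apart rows respects

compatible-refl : ∀ {n} {X : Graph n} → Stable X → Compatible X X
compatible-refl (apart , respects , _) = record
  { respects = respects ; apart = apart ; rows = λ _ → ↭-refl ; cols = λ _ → ↭-refl }

similar⇒compatible : ∀ {n} {X X̄ : Graph n} → Similar X X̄ → Compatible X X̄
similar⇒compatible (_ , (apart , _) , _ , rows×cols , ≡⇔diamond-↭) = record
  { respects = λ u v r s → Equivalence.to (≡⇔diamond-↭ u v r s)
  ; apart    = apart
  ; rows     = proj₁ ∘ rows×cols
  ; cols     = proj₂ ∘ rows×cols
  }

module CellRestriction {m n} (X : Graph n) (e : Fin m → Fin n) (e-injective : Injective _≡_ _≡_ e)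
  (image-closed : ∀ i j → X i i ≡ X j j → Image e i → Image e j) where

  InImageColumn : Label → Set
  InImageColumn l = ∃ λ k → Image e k × ∃ λ w → X w k ≡ l

  inImageColumn? : Decidable InImageColumn
  inImageColumn? l = any? λ k → image? e k ×-dec any? λ w → X w k ≟ᴸ l

  InImageRow : Label → Set
  InImageRow l = ∃ λ k → Image e k × ∃ λ w → X k w ≡ l

  inImageRow? : Decidable InImageRow
  inImageRow? l = any? λ k → image? e k ×-dec any? λ w → X k w ≟ᴸ l

  module _ {Y : Graph n} (c : Compatible X Y) where
    open Compatible c

    inImageColumn⇔image : ∀ w k → InImageColumn (Y w k) ⇔ Image e k
    inImageColumn⇔image w k = mk⇔
      (λ { (k′ , k′∈e , _ , Xw′k′≡Ywk) →
           image-closed k′ k (trans (column-cell apart respects diagonal Xw′k′≡Ywk) (sym (diagonal k))) k′∈e })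
      (λ k∈e → k , k∈e , map-allFin-↭⇒preimage (cols k) w)

    inImageRow⇔image : ∀ k w → InImageRow (Y k w) ⇔ Image e k
    inImageRow⇔image k w = mk⇔
      (λ { (k′ , k′∈e , _ , Xk′w′≡Ykw) →
           image-closed k′ k (trans (row-cell apart respects diagonal Xk′w′≡Ykw) (sym (diagonal k))) k′∈e })
      (λ k∈e → k , k∈e , map-allFin-↭⇒preimage (rows k) w)

  module _ {Y Z : Graph n} (cY : Compatible X Y) (cZ : Compatible X Z) where

    rowMS-sub-↭ : ∀ i → rowMS Y (e i) ↭ rowMS Z (e i) → rowMS (sub Y e) i ↭ rowMS (sub Z e) i
    rowMS-sub-↭ i = map-∘-↭ e e-injective inImageColumn?
      (inImageColumn⇔image cY (e i)) (inImageColumn⇔image cZ (e i))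

    colMS-sub-↭ : ∀ i → colMS Y (e i) ↭ colMS Z (e i) → colMS (sub Y e) i ↭ colMS (sub Z e) i
    colMS-sub-↭ i = map-∘-↭ e e-injective inImageRow?
      (λ k → inImageRow⇔image cY k (e i)) (λ k → inImageRow⇔image cZ k (e i))

    respects-sub : DiamondRespects Y Z → DiamondRespects (sub Y e) (sub Z e)
    respects-sub respects a b c d eq = map-∘-↭ e e-injective (inImageColumn? ∘ proj₁)
      (inImageColumn⇔image cY (e a)) (inImageColumn⇔image cZ (e c)) (respects _ _ _ _ eq)

  stable-sub : ∀ {Y : Graph n} → Compatible X Y → Stable Y → Stable (sub Y e)
  stable-sub {Y} cY (apart , respects , _) =
    apart-sub e-injective apart ,
    respects-sub cY cY respects ,
    λ _ _ _ _ → diamond-↭⇒≡ {Y = sub Y e} (apart-sub e-injective apart) (λ _ → refl)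

corollary4p4 : ∀ (n : ℕ) (X X̄ : Graph n) → Similar X X̄ →
    (S : Subset n) → NonemptyS S → UnionOfCells X S →
    (m : ℕ) (e : Fin m → Fin n) → OrderEnum S e →
    Similar (sub X e) (sub X̄ e)
corollary4p4 _ X X̄ similar@(X-stable , X̄-stable , sameCells , _) _ _ S-cells _ e (increasing , S⇔image) =
  stable-sub cX X-stable ,
  stable-sub cX̄ X̄-stable ,
  (λ a b → sameCells (e a) (e b)) ,
  (λ a → rowMS-sub-↭ cX cX̄ a (rows (e a)) , colMS-sub-↭ cX cX̄ a (cols (e a))) ,
  λ a b c d → mk⇔
    (respects-sub cX cX̄ respects a b c d)
    (diamond-↭⇒≡ {Y = sub X e} (apart-sub e-injective apart) (diagonal ∘ e))
  where
  e-injective : Injective _≡_ _≡_ e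
  e-injective = strictlyIncreasing⇒injective increasing

  open CellRestriction X e e-injective
    (λ i j Xii≡Xjj → Equivalence.to (S⇔image j) ∘ S-cells i j Xii≡Xjj ∘ Equivalence.from (S⇔image i))

  cX : Compatible X X
  cX = compatible-refl X-stable

  cX̄ : Compatible X X̄
  cX̄ = similar⇒compatible similar

  open Compatible cX̄
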